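{- Let $w\in\mathfrak S_n$. For each $1\le i<\ell(w)$ the map $\mathfrak c_i$, and for each $1<i<\ell(w)$ the map $\mathfrak b_i$, is a well-defined involution on the set $\mathrm{SBT}(w)$ of standard balanced tableaux of shape $\mathbb D(w)$.
   Context: $\ell(w)$ is the number of pairs $i<j$ with $w_i>w_j$. The Rothe diagram $\mathbb D(w)=\{(i,w_j)\mid i<j,\ w_i>w_j\}$, the cell $(i,w_j)$ lying in row $i$ (rows numbered bottom to top) and column $w_j$; it has $\ell(w)$ cells. A standard balanced tableau of shape $\mathbb D(w)$ is a bijective filling of its cells with $\{1,\ldots,\ell(w)\}$ such that for every cell, the number of cells to its right in the same row with larger entry equals the number of cells above it in the same column with smaller entry. $\mathfrak c_i$ acts on such a tableau by exchanging the entries $i$ and $i+1$ if they are neither in the same row nor in the same column, and is the identity otherwise. $\mathfrak b_i$ acts by exchanging the entries $i-1$ and $i+1$ if one of them lies in the same column as $i$ and above it, and the other lies in the same row as $i$ and to its right; it is the identity otherwise. -}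

module Defs where

open import Data.Nat using (ℕ; zero; suc; _+_; _≤_; _<ᵇ_; _≡ᵇ_)
open import Data.Bool using (Bool; true; false; _∧_; _∨_; if_then_else_)
open import Data.Fin using (Fin; toℕ)
open import Data.Fin.Permutation using (Permutation′; _⟨$⟩ʳ_)
open import Data.List using (List; []; _∷_; allFin; concatMap; map)
open import Data.Maybe using (Maybe; just; nothing)
open import Data.Product using (_×_; _,_; Σ-syntax; ∃-syntax)
open import Relation.Binary.PropositionalEquality using (_≡_)

-- Conventions: rows and columns are indexed by Fin n (0-based; order-preserving
-- relabelling of 1..n).  Row index grows from bottom to top, so "above" means a
-- strictly larger row index; "to the right" means a strictly larger column index.

count : ∀ {n} → (Fin n → Bool) → ℕ
count {zero}  p = 0
count {suc n} p = (if p Data.Fin.zero then 1 else 0) + count (λ i → p (Data.Fin.suc i))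

sumF : ∀ {n} → (Fin n → ℕ) → ℕ
sumF {zero}  f = 0
sumF {suc n} f = f Data.Fin.zero + sumF (λ i → f (Data.Fin.suc i))

_<F_ : ∀ {n} → Fin n → Fin n → Bool
i <F j = toℕ i <ᵇ toℕ j

_=F_ : ∀ {n} → Fin n → Fin n → Bool
i =F j = toℕ i ≡ᵇ toℕ j

anyF : ∀ {n} → (Fin n → Bool) → Bool
anyF {zero}  p = false
anyF {suc n} p = p Data.Fin.zero ∨ anyF (λ i → p (Data.Fin.suc i))

len : ∀ {n} → Permutation′ n → ℕ
len w = sumF (λ i → count (λ j → (i <F j) ∧ ((w ⟨$⟩ʳ j) <F (w ⟨$⟩ʳ i))))

inDᵇ : ∀ {n} → Permutation′ n → Fin n → Fin n → Bool
inDᵇ w r c = anyF (λ j → (r <F j) ∧ ((w ⟨$⟩ʳ j) <F (w ⟨$⟩ʳ r)) ∧ (c =F (w ⟨$⟩ʳ j)))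

InD : ∀ {n} → Permutation′ n → Fin n → Fin n → Set
InD w r c = inDᵇ w r c ≡ true

-- A filling assigns a natural number to each position (row, column);
-- only its values on cells of D(w) are meaningful.
Filling : ℕ → Set
Filling n = Fin n → Fin n → ℕ

IsStandard : ∀ {n} → Permutation′ n → Filling n → Set
IsStandard w T =
    (∀ r c → InD w r c → 1 ≤ T r c × T r c ≤ len w)
  × (∀ r c r′ c′ → InD w r c → InD w r′ c′ → T r c ≡ T r′ c′ → (r ≡ r′ × c ≡ c′))
  × (∀ k → 1 ≤ k → k ≤ len w → ∃[ r ] ∃[ c ] (InD w r c × T r c ≡ k))

rightLarger : ∀ {n} → Permutation′ n → Filling n → Fin n → Fin n → ℕ
rightLarger w T r c = count (λ c′ → inDᵇ w r c′ ∧ (c <F c′) ∧ (T r c <ᵇ T r c′))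

aboveSmaller : ∀ {n} → Permutation′ n → Filling n → Fin n → Fin n → ℕ
aboveSmaller w T r c = count (λ r′ → inDᵇ w r′ c ∧ (r <F r′) ∧ (T r′ c <ᵇ T r c))

IsBalanced : ∀ {n} → Permutation′ n → Filling n → Set
IsBalanced w T = ∀ r c → InD w r c → rightLarger w T r c ≡ aboveSmaller w T r c

IsSBT : ∀ {n} → Permutation′ n → Filling n → Set
IsSBT w T = IsStandard w T × IsBalanced w T

-- two fillings define the same tableau iff they agree on D(w)
_≈[_]_ : ∀ {n} → Filling n → Permutation′ n → Filling n → Set
T ≈[ w ] T′ = ∀ r c → InD w r c → T r c ≡ T′ r c

Cell : ℕ → Set
Cell n = Fin n × Fin n

cells : ∀ n → List (Cell n)
cells n = concatMap (λ r → map (λ c → (r , c)) (allFin n)) (allFin n)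

findCell : ∀ {n} → (Cell n → Bool) → List (Cell n) → Maybe (Cell n)
findCell p []       = nothing
findCell p (x ∷ xs) = if p x then just x else findCell p xs

posOf : ∀ {n} → Permutation′ n → Filling n → ℕ → Maybe (Cell n)
posOf {n} w T k = findCell (λ { (r , c) → inDᵇ w r c ∧ (T r c ≡ᵇ k) }) (cells n)

swapIf : ∀ {n} → Permutation′ n → Bool → ℕ → ℕ → Filling n → Filling n
swapIf w cond a b T r c =
  if cond ∧ inDᵇ w r c
  then (if T r c ≡ᵇ a then b else if T r c ≡ᵇ b then a else T r c)
  else T r c

cCond : ∀ {n} → Maybe (Cell n) → Maybe (Cell n) → Bool
cCond (just (r , c)) (just (r′ , c′)) = Data.Bool.not (r =F r′) ∧ Data.Bool.not (c =F c′)
cCond _ _ = false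

𝔠 : ∀ {n} → Permutation′ n → ℕ → Filling n → Filling n
𝔠 w i T = swapIf w (cCond (posOf w T i) (posOf w T (suc i))) i (suc i) T

aboveSameCol : ∀ {n} → Cell n → Cell n → Bool
aboveSameCol (r , c) (r′ , c′) = (c =F c′) ∧ (r′ <F r)

rightSameRow : ∀ {n} → Cell n → Cell n → Bool
rightSameRow (r , c) (r′ , c′) = (r =F r′) ∧ (c′ <F c)

bCond : ∀ {n} → Maybe (Cell n) → Maybe (Cell n) → Maybe (Cell n) → Bool
bCond (just p) (just q) (just s) =
  (aboveSameCol p q ∧ rightSameRow s q) ∨ (aboveSameCol s q ∧ rightSameRow p q)
bCond _ _ _ = false

𝔟 : ∀ {n} → Permutation′ n → ℕ → Filling n → Filling n
𝔟 w i T = swapIf w (bCond (posOf w T (i Data.Nat.∸ 1)) (posOf w T i) (posOf w T (suc i)))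
                    (i Data.Nat.∸ 1) (suc i) T

module Submission where

-- Both moves have the same form: if a condition on the positions of a few entries
-- holds, exchange two entries a < b on every cell of D(w).  Write σ for the
-- transposition of the values a and b.
--  * Exchanging a and b keeps a filling standard (σ permutes {1, …, ℓ(w)}), moves the
--    position of every entry k to that of σ k, and undoes itself.
--  * σ preserves the order of two values unless both lie in the window [a, b].  So the
--    balance condition at a cell survives the exchange as soon as neither its row (to
--    the right) nor its column (above) holds a cell forming with it a pair of window
--    values (balanced-away-from-window).
--  * For 𝔠ᵢ the window {i, i+1} sits on two cells in different rows and columns, so no
--    such pair exists.  For 𝔟ᵢ the window {i-1, i, i+1} sits on a hook: the cell q of i,
--    a cell above q and a cell right of q.  Only q is critical, and there the two counts
--    of the balance condition change by one in the same direction.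
--  * The move conditions are symmetric in a and b, so they still hold after the
--    exchange; hence applying a move twice exchanges back (conditional-swap-involution).

open import Defs
open import Data.Nat using (ℕ; _≤_; _<_)
open import Data.Fin.Permutation using (Permutation′)
open import Data.Product using (_×_)

open import Data.Nat using (zero; suc; _+_; _<ᵇ_; _≡ᵇ_)
open import Data.Nat.Properties
  using (≡ᵇ⇒≡; ≡⇒≡ᵇ; <ᵇ⇒<; <⇒<ᵇ; _≟_; _<?_; n<1+n; <⇒≤; <⇒≢; ≮⇒≥; ≤∧≢⇒<; ≤-antisym; <-irrefl;
         <-asym; <-trans; <-≤-trans; ≤-<-trans; ≤-trans; ≤-refl; ≤-pred; +-suc)
  renaming (suc-injective to ℕ-suc-injective)
open import Data.Bool using (Bool; true; false; _∧_; _∨_; not; if_then_else_) renaming (T to IsTrue)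
open import Data.Bool.Properties using (∧-conicalˡ; ∧-conicalʳ; ∨-comm)
open import Data.Fin using (Fin; toℕ) renaming (zero to fzero; suc to fsuc)
open import Data.Fin.Properties using (toℕ-injective) renaming (_≟_ to _≟F_; suc-injective to Fin-suc-injective)
open import Data.Product using (_,_; proj₁; proj₂; Σ; ∃-syntax)
open import Data.Sum using (_⊎_; inj₁; inj₂)
open import Data.Maybe using (Maybe; just; nothing)
open import Data.List using ([]; _∷_)
open import Data.Unit using (tt)
open import Data.Empty using (⊥; ⊥-elim)
open import Relation.Nullary using (¬_; yes; no)
open import Relation.Binary.PropositionalEquality

if-true : ∀ {A : Set} {c : Bool} {x y : A} → c ≡ true → (if c then x else y) ≡ x
if-true refl = refl

if-false : ∀ {A : Set} {c : Bool} {x y : A} → c ≡ false → (if c then x else y) ≡ y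
if-false refl = refl

refute : ∀ {b : Bool} {P : Set} → (b ≡ true → P) → ¬ P → b ≡ false
refute {false} _ _ = refl
refute {true} sound ¬p = ⊥-elim (¬p (sound refl))

≡true⇒T : ∀ {b} → b ≡ true → IsTrue b
≡true⇒T refl = tt

T⇒≡true : ∀ {b} → IsTrue b → b ≡ true
T⇒≡true {true} _ = refl

≡ᵇ-complete : ∀ {m n} → m ≡ n → (m ≡ᵇ n) ≡ true
≡ᵇ-complete {m} {n} m≡n = T⇒≡true (≡⇒≡ᵇ m n m≡n)

≡ᵇ-sound : ∀ {m n} → (m ≡ᵇ n) ≡ true → m ≡ n
≡ᵇ-sound {m} {n} e = ≡ᵇ⇒≡ m n (≡true⇒T e)

≡ᵇ-false : ∀ {m n} → m ≢ n → (m ≡ᵇ n) ≡ false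
≡ᵇ-false = refute ≡ᵇ-sound

≡ᵇ-sym : ∀ m n → (m ≡ᵇ n) ≡ (n ≡ᵇ m)
≡ᵇ-sym zero    zero    = refl
≡ᵇ-sym zero    (suc n) = refl
≡ᵇ-sym (suc m) zero    = refl
≡ᵇ-sym (suc m) (suc n) = ≡ᵇ-sym m n

<ᵇ-complete : ∀ {m n} → m < n → (m <ᵇ n) ≡ true
<ᵇ-complete m<n = T⇒≡true (<⇒<ᵇ m<n)

<ᵇ-sound : ∀ {m n} → (m <ᵇ n) ≡ true → m < n
<ᵇ-sound {m} {n} e = <ᵇ⇒< m n (≡true⇒T e)

<ᵇ-false : ∀ {m n} → ¬ m < n → (m <ᵇ n) ≡ false
<ᵇ-false = refute <ᵇ-sound

∧-left : ∀ {x y} → (x ∧ y) ≡ true → x ≡ true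
∧-left {x} {y} = ∧-conicalˡ x y

∧-right : ∀ {x y} → (x ∧ y) ≡ true → y ≡ true
∧-right {x} {y} = ∧-conicalʳ x y

∨-cases : ∀ {x y} → (x ∨ y) ≡ true → x ≡ true ⊎ y ≡ true
∨-cases {true} _ = inj₁ refl
∨-cases {false} e = inj₂ e

not-true : ∀ {x} → not x ≡ true → x ≡ false
not-true {false} _ = refl

∧-guard : ∀ x {y z} → (x ≡ true → y ≡ z) → (x ∧ y) ≡ (x ∧ z)
∧-guard true y≡z = y≡z refl
∧-guard false _ = refl

=F-sound : ∀ {m} {r r′ : Fin m} → (r =F r′) ≡ true → r ≡ r′
=F-sound e = toℕ-injective (≡ᵇ-sound e)

=F-false : ∀ {m} {r r′ : Fin m} → (r =F r′) ≡ false → r ≢ r′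
=F-false {r = r} e refl with trans (sym (≡ᵇ-complete {toℕ r} refl)) e
... | ()

≡⇒≮ : ∀ {m} {c c′ : Fin m} → c ≡ c′ → toℕ c < toℕ c′ → ⊥
≡⇒≮ refl = <-irrefl refl

count-cong : ∀ {m} {p q : Fin m → Bool} → (∀ x → p x ≡ q x) → count p ≡ count q
count-cong {zero} _ = refl
count-cong {suc m} p≡q =
  cong₂ _+_ (cong (λ b → if b then 1 else 0) (p≡q fzero)) (count-cong (λ x → p≡q (fsuc x)))

count-extra : ∀ {m} (p q : Fin m → Bool) (x₀ : Fin m) → (∀ x → x ≢ x₀ → p x ≡ q x) →
              p x₀ ≡ true → q x₀ ≡ false → count p ≡ suc (count q)
count-extra {suc m} p q fzero agree px₀ qx₀
  rewrite px₀ | qx₀ = cong suc (count-cong (λ x → agree (fsuc x) (λ ())))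
count-extra {suc m} p q (fsuc x₀) agree px₀ qx₀
  rewrite agree fzero (λ ()) =
  trans (cong (_ +_)
               (count-extra (λ x → p (fsuc x)) (λ x → q (fsuc x)) x₀
                  (λ x x≢x₀ → agree (fsuc x) (λ e → x≢x₀ (Fin-suc-injective e))) px₀ qx₀))
        (+-suc _ _)

findCell-sound : ∀ {n} (p : Cell n → Bool) xs {x} → findCell p xs ≡ just x → p x ≡ true
findCell-sound p (y ∷ xs) e with p y in py | e
... | true  | refl = py
... | false | e′   = findCell-sound p xs e′

findCell-cong : ∀ {n} {p q : Cell n → Bool} → (∀ x → p x ≡ q x) → ∀ xs → findCell p xs ≡ findCell q xs
findCell-cong p≡q [] = refl
findCell-cong p≡q (y ∷ xs) = cong₂ (λ b r → if b then just y else r) (p≡q y) (findCell-cong p≡q xs)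

posOf-sound : ∀ {n} (w : Permutation′ n) (T : Filling n) {k r c} →
              posOf w T k ≡ just (r , c) → InD w r c × T r c ≡ k
posOf-sound {n} w T {r = r} {c} e = ∧-left found , ≡ᵇ-sound (∧-right {inDᵇ w r c} found)
  where found = findCell-sound _ (cells n) e

same-cell : ∀ {n} (w : Permutation′ n) (T : Filling n) → IsStandard w T →
            ∀ {r c r′ c′} → InD w r c → InD w r′ c′ → T r c ≡ T r′ c′ → r ≡ r′ × c ≡ c′
same-cell w T (_ , injective , _) = injective _ _ _ _

swap-off : ∀ {n} (w : Permutation′ n) {cond} a b (U : Filling n) r c → cond ≡ false → swapIf w cond a b U r c ≡ U r c
swap-off w a b U r c refl = refl

rightLargerTest : ∀ {n} → Permutation′ n → Filling n → Fin n → Fin n → Fin n → Bool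
rightLargerTest w T r c c′ = inDᵇ w r c′ ∧ (c <F c′) ∧ (T r c <ᵇ T r c′)

aboveSmallerTest : ∀ {n} → Permutation′ n → Filling n → Fin n → Fin n → Fin n → Bool
aboveSmallerTest w T r c r′ = inDᵇ w r′ c ∧ (r <F r′) ∧ (T r′ c <ᵇ T r c)

module Transposition (a b : ℕ) (a<b : a < b) where

  σ : ℕ → ℕ
  σ y = if y ≡ᵇ a then b else if y ≡ᵇ b then a else y

  σ-a : σ a ≡ b
  σ-a = if-true (≡ᵇ-complete {a} refl)

  σ-b : σ b ≡ a
  σ-b = trans (if-false (≡ᵇ-false (λ b≡a → <⇒≢ a<b (sym b≡a)))) (if-true (≡ᵇ-complete {b} refl))

  σ-fixed : ∀ {y} → y ≢ a → y ≢ b → σ y ≡ y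
  σ-fixed y≢a y≢b = trans (if-false (≡ᵇ-false y≢a)) (if-false (≡ᵇ-false y≢b))

  σ-between : ∀ {y} → a < y → y < b → σ y ≡ y
  σ-between a<y y<b = σ-fixed (λ y≡a → <⇒≢ a<y (sym y≡a)) (<⇒≢ y<b)

  σ-involutive : ∀ y → σ (σ y) ≡ y
  σ-involutive y with y ≟ a | y ≟ b
  ... | yes refl | _ = trans (cong σ σ-a) σ-b
  ... | no _ | yes refl = trans (cong σ σ-b) σ-a
  ... | no y≢a | no y≢b = trans (cong σ (σ-fixed y≢a y≢b)) (σ-fixed y≢a y≢b)

  σ-injective : ∀ {x y} → σ x ≡ σ y → x ≡ y
  σ-injective {x} {y} e = trans (sym (σ-involutive x)) (trans (cong σ e) (σ-involutive y))

  σ-≡ᵇ : ∀ y k → (σ y ≡ᵇ k) ≡ (y ≡ᵇ σ k)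
  σ-≡ᵇ y k with y ≟ σ k
  ... | yes refl = trans (≡ᵇ-complete (σ-involutive k)) (sym (≡ᵇ-complete {σ k} refl))
  ... | no y≢σk = trans (≡ᵇ-false {σ y} {k} (λ e → y≢σk (trans (sym (σ-involutive y)) (cong σ e)))) (sym (≡ᵇ-false y≢σk))

  σ-range : ∀ {L y} → 1 ≤ a → b ≤ L → 1 ≤ y × y ≤ L → 1 ≤ σ y × σ y ≤ L
  σ-range {L} {y} 1≤a b≤L y-in with y ≟ a | y ≟ b
  ... | yes refl | _ = subst (λ v → 1 ≤ v × v ≤ L) (sym σ-a) (≤-trans 1≤a (<⇒≤ a<b) , b≤L)
  ... | no _ | yes refl = subst (λ v → 1 ≤ v × v ≤ L) (sym σ-b) (1≤a , ≤-trans (<⇒≤ a<b) b≤L)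
  ... | no y≢a | no y≢b = subst (λ v → 1 ≤ v × v ≤ L) (sym (σ-fixed y≢a y≢b)) y-in

  -- The window [a, b]: the only values whose relative order σ can change.
  Window : ℕ → Set
  Window y = a ≤ y × y ≤ b

  Outside : ℕ → Set
  Outside y = y < a ⊎ b < y

  window-or-outside : ∀ y → Window y ⊎ Outside y
  window-or-outside y with y <? a | b <? y
  ... | yes y<a | _ = inj₂ (inj₁ y<a)
  ... | no _ | yes b<y = inj₂ (inj₂ b<y)
  ... | no y≮a | no b≮y = inj₁ (≮⇒≥ y≮a , ≮⇒≥ b≮y)

  σ-outside : ∀ {y} → Outside y → σ y ≡ y
  σ-outside (inj₁ y<a) = σ-fixed (<⇒≢ y<a) (<⇒≢ (<-trans y<a a<b))
  σ-outside (inj₂ b<y) = σ-fixed (λ e → <⇒≢ (<-trans a<b b<y) (sym e)) (λ e → <⇒≢ b<y (sym e))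

  σ-window : ∀ {y} → Window y → Window (σ y)
  σ-window {y} y-in with y ≟ a | y ≟ b
  ... | yes refl | _ = subst Window (sym σ-a) (<⇒≤ a<b , ≤-refl)
  ... | no _ | yes refl = subst Window (sym σ-b) (≤-refl , <⇒≤ a<b)
  ... | no y≢a | no y≢b = subst Window (sym (σ-fixed y≢a y≢b)) y-in

  outside-vs-window : ∀ {x y y′} → Outside x → Window y → Window y′ →
                      ((x <ᵇ y) ≡ (x <ᵇ y′)) × ((y <ᵇ x) ≡ (y′ <ᵇ x))
  outside-vs-window (inj₁ x<a) (a≤y , _) (a≤y′ , _) =
    trans (<ᵇ-complete (<-≤-trans x<a a≤y)) (sym (<ᵇ-complete (<-≤-trans x<a a≤y′))) ,
    trans (<ᵇ-false (λ y<x → <-asym y<x (<-≤-trans x<a a≤y)))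
          (sym (<ᵇ-false (λ y′<x → <-asym y′<x (<-≤-trans x<a a≤y′))))
  outside-vs-window (inj₂ b<x) (_ , y≤b) (_ , y′≤b) =
    trans (<ᵇ-false (λ x<y → <-asym x<y (≤-<-trans y≤b b<x)))
          (sym (<ᵇ-false (λ x<y′ → <-asym x<y′ (≤-<-trans y′≤b b<x)))) ,
    trans (<ᵇ-complete (≤-<-trans y≤b b<x)) (sym (<ᵇ-complete (≤-<-trans y′≤b b<x)))

  σ-order : ∀ x y → ((σ x <ᵇ σ y) ≡ (x <ᵇ y)) ⊎ (Window x × Window y)
  σ-order x y with window-or-outside x | window-or-outside y
  ... | inj₂ x-out | inj₂ y-out = inj₁ (cong₂ _<ᵇ_ (σ-outside x-out) (σ-outside y-out))
  ... | inj₂ x-out | inj₁ y-in =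
    inj₁ (trans (cong (_<ᵇ σ y) (σ-outside x-out)) (sym (proj₁ (outside-vs-window x-out y-in (σ-window y-in)))))
  ... | inj₁ x-in | inj₂ y-out =
    inj₁ (trans (cong (σ x <ᵇ_) (σ-outside y-out)) (sym (proj₂ (outside-vs-window y-out x-in (σ-window x-in)))))
  ... | inj₁ x-in | inj₁ y-in = inj₂ (x-in , y-in)

  module Exchange {n} (w : Permutation′ n) (T : Filling n) where

    T′ : Filling n
    T′ = swapIf w true a b T

    T′-on-D : ∀ {r c} → InD w r c → T′ r c ≡ σ (T r c)
    T′-on-D {r} {c} d = if-true {c = inDᵇ w r c} d

    -- Since σ permutes {1, …, ℓ(w)}, the exchange keeps T standard.
    standard : 1 ≤ a → b ≤ len w → IsStandard w T → IsStandard w T′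
    standard 1≤a b≤ℓ (bounded , injective , surjective) = bounded′ , injective′ , surjective′
      where
      bounded′ : ∀ r c → InD w r c → 1 ≤ T′ r c × T′ r c ≤ len w
      bounded′ r c d = subst (λ v → 1 ≤ v × v ≤ len w) (sym (T′-on-D d)) (σ-range 1≤a b≤ℓ (bounded r c d))
      injective′ : ∀ r c r′ c′ → InD w r c → InD w r′ c′ → T′ r c ≡ T′ r′ c′ → r ≡ r′ × c ≡ c′
      injective′ r c r′ c′ d d′ e = injective r c r′ c′ d d′ (σ-injective (trans (sym (T′-on-D d)) (trans e (T′-on-D d′))))
      surjective′ : ∀ k → 1 ≤ k → k ≤ len w → ∃[ r ] ∃[ c ] (InD w r c × T′ r c ≡ k)
      surjective′ k 1≤k k≤ℓ with σ-range 1≤a b≤ℓ (1≤k , k≤ℓ)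
      ... | 1≤σk , σk≤ℓ with surjective (σ k) 1≤σk σk≤ℓ
      ...   | r , c , d , e = r , c , d , trans (T′-on-D d) (trans (cong σ e) (σ-involutive k))

    posOf-T′ : ∀ k → posOf w T′ k ≡ posOf w T (σ k)
    posOf-T′ k = findCell-cong (λ { (r , c) → ∧-guard (inDᵇ w r c) (λ d → trans (cong (_≡ᵇ k) (T′-on-D d)) (σ-≡ᵇ (T r c) k)) }) (cells n)

    swap-back : ∀ {cond} → cond ≡ true → swapIf w cond a b T′ ≈[ w ] T
    swap-back refl r c d = trans (if-true {c = inDᵇ w r c} d) (trans (cong σ (T′-on-D d)) (σ-involutive (T r c)))

    rightLargerTest-T′ : ∀ r c c′ → InD w r c →
      (InD w r c′ → toℕ c < toℕ c′ → Window (T r c) → Window (T r c′) → ⊥) →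
      rightLargerTest w T′ r c c′ ≡ rightLargerTest w T r c c′
    rightLargerTest-T′ r c c′ d no-pair =
      ∧-guard (inDᵇ w r c′) λ d′ → ∧-guard (c <F c′) λ c<c′ →
        trans (cong₂ _<ᵇ_ (T′-on-D d) (T′-on-D d′)) (order-kept d′ (<ᵇ-sound c<c′))
      where
      order-kept : InD w r c′ → toℕ c < toℕ c′ → (σ (T r c) <ᵇ σ (T r c′)) ≡ (T r c <ᵇ T r c′)
      order-kept d′ c<c′ with σ-order (T r c) (T r c′)
      ... | inj₁ kept = kept
      ... | inj₂ (x-in , y-in) = ⊥-elim (no-pair d′ c<c′ x-in y-in)

    aboveSmallerTest-T′ : ∀ r c r′ → InD w r c →
      (InD w r′ c → toℕ r < toℕ r′ → Window (T r c) → Window (T r′ c) → ⊥) →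
      aboveSmallerTest w T′ r c r′ ≡ aboveSmallerTest w T r c r′
    aboveSmallerTest-T′ r c r′ d no-pair =
      ∧-guard (inDᵇ w r′ c) λ d′ → ∧-guard (r <F r′) λ r<r′ →
        trans (cong₂ _<ᵇ_ (T′-on-D d′) (T′-on-D d)) (order-kept d′ (<ᵇ-sound r<r′))
      where
      order-kept : InD w r′ c → toℕ r < toℕ r′ → (σ (T r′ c) <ᵇ σ (T r c)) ≡ (T r′ c <ᵇ T r c)
      order-kept d′ r<r′ with σ-order (T r′ c) (T r c)
      ... | inj₁ kept = kept
      ... | inj₂ (y-in , x-in) = ⊥-elim (no-pair d′ r<r′ x-in y-in)

    balanced-away-from-window : IsBalanced w T → ∀ r c → InD w r c →
      (∀ c′ → InD w r c′ → toℕ c < toℕ c′ → Window (T r c) → Window (T r c′) → ⊥) →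
      (∀ r′ → InD w r′ c → toℕ r < toℕ r′ → Window (T r c) → Window (T r′ c) → ⊥) →
      rightLarger w T′ r c ≡ aboveSmaller w T′ r c
    balanced-away-from-window balanced r c d no-row-pair no-column-pair = begin
      rightLarger w T′ r c ≡⟨ count-cong (λ c′ → rightLargerTest-T′ r c c′ d (no-row-pair c′)) ⟩
      rightLarger w T r c  ≡⟨ balanced r c d ⟩
      aboveSmaller w T r c ≡⟨ count-cong (λ r′ → sym (aboveSmallerTest-T′ r c r′ d (no-column-pair r′))) ⟩
      aboveSmaller w T′ r c ∎
      where open ≡-Reasoning

  open Exchange using (standard; swap-back)

  conditional-swap-involution : ∀ {n} (w : Permutation′ n) (cond : Filling n → Bool) →
    1 ≤ a → b ≤ len w →
    (∀ T → cond T ≡ true → cond (swapIf w true a b T) ≡ true) →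
    (∀ T → IsSBT w T → cond T ≡ true → IsBalanced w (swapIf w true a b T)) →
    ∀ T → IsSBT w T →
    IsSBT w (swapIf w (cond T) a b T) ×
    (swapIf w (cond (swapIf w (cond T) a b T)) a b (swapIf w (cond T) a b T) ≈[ w ] T)
  conditional-swap-involution w cond 1≤a b≤ℓ cond-stable balanced T sbt with cond T in e
  ... | false = sbt , λ r c _ → swap-off w a b T r c e
  ... | true  = (standard w T 1≤a b≤ℓ (proj₁ sbt) , balanced T sbt e) , swap-back w T (cond-stable T e)

cCond-cells : ∀ {n} (x y : Maybe (Cell n)) → cCond x y ≡ true →
  Σ (Cell n) λ P → Σ (Cell n) λ Q → x ≡ just P × y ≡ just Q × proj₁ P ≢ proj₁ Q × proj₂ P ≢ proj₂ Q
cCond-cells (just (r , c)) (just (r′ , c′)) e =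
  (r , c) , (r′ , c′) , refl , refl , =F-false (not-true (∧-left e)) , =F-false (not-true (∧-right {not (r =F r′)} e))

cCond-sym : ∀ {n} (x y : Maybe (Cell n)) → cCond x y ≡ cCond y x
cCond-sym (just (r , c)) (just (r′ , c′)) =
  cong₂ (λ u v → not u ∧ not v) (≡ᵇ-sym (toℕ r) (toℕ r′)) (≡ᵇ-sym (toℕ c) (toℕ c′))
cCond-sym (just _) nothing = refl
cCond-sym nothing (just _) = refl
cCond-sym nothing nothing = refl

-- Exchanging i and i+1 placed on P = (rP , cP) and Q = (rQ , cQ), in different rows and
-- columns, keeps T balanced: no row or column holds two window values.
module Move𝔠 {n} (w : Permutation′ n) (i : ℕ) (T : Filling n) (sbt : IsSBT w T)
  (rP cP rQ cQ : Fin n) (dP : InD w rP cP) (tP : T rP cP ≡ i) (dQ : InD w rQ cQ) (tQ : T rQ cQ ≡ suc i)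
  (rP≢rQ : rP ≢ rQ) (cP≢cQ : cP ≢ cQ) where

  open Transposition i (suc i) (n<1+n i)
  open Exchange w T

  window-cell : ∀ r c → InD w r c → Window (T r c) → (r ≡ rP × c ≡ cP) ⊎ (r ≡ rQ × c ≡ cQ)
  window-cell r c d (i≤y , y≤i+1) with T r c ≟ i
  ... | yes y≡i = inj₁ (same-cell w T (proj₁ sbt) d dP (trans y≡i (sym tP)))
  ... | no y≢i = inj₂ (same-cell w T (proj₁ sbt) d dQ (trans (≤-antisym y≤i+1 (≤∧≢⇒< i≤y (λ e → y≢i (sym e)))) (sym tQ)))

  no-row-pair : ∀ r c c′ → InD w r c → InD w r c′ → toℕ c < toℕ c′ → Window (T r c) → Window (T r c′) → ⊥
  no-row-pair r c c′ d d′ c<c′ x-in y-in with window-cell r c d x-in | window-cell r c′ d′ y-in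
  ... | inj₁ (_ , c≡cP) | inj₁ (_ , c′≡cP) = ≡⇒≮ (trans c≡cP (sym c′≡cP)) c<c′
  ... | inj₁ (r≡rP , _) | inj₂ (r≡rQ , _) = rP≢rQ (trans (sym r≡rP) r≡rQ)
  ... | inj₂ (r≡rQ , _) | inj₁ (r≡rP , _) = rP≢rQ (trans (sym r≡rP) r≡rQ)
  ... | inj₂ (_ , c≡cQ) | inj₂ (_ , c′≡cQ) = ≡⇒≮ (trans c≡cQ (sym c′≡cQ)) c<c′

  no-column-pair : ∀ r r′ c → InD w r c → InD w r′ c → toℕ r < toℕ r′ → Window (T r c) → Window (T r′ c) → ⊥
  no-column-pair r r′ c d d′ r<r′ x-in y-in with window-cell r c d x-in | window-cell r′ c d′ y-in
  ... | inj₁ (r≡rP , _) | inj₁ (r′≡rP , _) = ≡⇒≮ (trans r≡rP (sym r′≡rP)) r<r′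
  ... | inj₁ (_ , c≡cP) | inj₂ (_ , c≡cQ) = cP≢cQ (trans (sym c≡cP) c≡cQ)
  ... | inj₂ (_ , c≡cQ) | inj₁ (_ , c≡cP) = cP≢cQ (trans (sym c≡cP) c≡cQ)
  ... | inj₂ (r≡rQ , _) | inj₂ (r′≡rQ , _) = ≡⇒≮ (trans r≡rQ (sym r′≡rQ)) r<r′

  balanced : IsBalanced w T′
  balanced r c d = balanced-away-from-window (proj₂ sbt) r c d
    (λ c′ d′ → no-row-pair r c c′ d d′) (λ r′ d′ → no-column-pair r r′ c d d′)

𝔠-involution : ∀ {n} (w : Permutation′ n) (i : ℕ) → 1 ≤ i → i < len w → ∀ (T : Filling n) → IsSBT w T →
               IsSBT w (𝔠 w i T) × (𝔠 w i (𝔠 w i T) ≈[ w ] T)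
𝔠-involution w i 1≤i i<ℓ = conditional-swap-involution w cond 1≤i i<ℓ cond-stable balanced
  where
  open Transposition i (suc i) (n<1+n i)

  cond : Filling _ → Bool
  cond T = cCond (posOf w T i) (posOf w T (suc i))

  -- After the exchange, i and i+1 sit where i+1 and i sat.
  cond-stable : ∀ T → cond T ≡ true → cond (swapIf w true i (suc i) T) ≡ true
  cond-stable T e = begin
    cCond (posOf w T′ i) (posOf w T′ (suc i))         ≡⟨ cong₂ cCond (posOf-T′ i) (posOf-T′ (suc i)) ⟩
    cCond (posOf w T (σ i)) (posOf w T (σ (suc i)))   ≡⟨ cong₂ (λ k l → cCond (posOf w T k) (posOf w T l)) σ-a σ-b ⟩
    cCond (posOf w T (suc i)) (posOf w T i)           ≡⟨ cCond-sym (posOf w T (suc i)) (posOf w T i) ⟩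
    cCond (posOf w T i) (posOf w T (suc i))           ≡⟨ e ⟩
    true ∎
    where open ≡-Reasoning
          open Exchange w T

  balanced : ∀ T → IsSBT w T → cond T ≡ true → IsBalanced w (swapIf w true i (suc i) T)
  balanced T sbt e with cCond-cells _ _ e
  ... | (rP , cP) , (rQ , cQ) , eP , eQ , rP≢rQ , cP≢cQ =
    let (dP , tP) = posOf-sound w T eP
        (dQ , tQ) = posOf-sound w T eQ
    in Move𝔠.balanced w i T sbt rP cP rQ cQ dP tP dQ tQ rP≢rQ cP≢cQ

Hook : ∀ {n} → Cell n → Cell n → Cell n → Set
Hook (rX , cX) (rq , cq) (rY , cY) = cX ≡ cq × toℕ rq < toℕ rX × rY ≡ rq × toℕ cq < toℕ cY

hook : ∀ {n} (X q Y : Cell n) → (aboveSameCol X q ∧ rightSameRow Y q) ≡ true → Hook X q Y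
hook (rX , cX) (rq , cq) (rY , cY) e =
  =F-sound (∧-left above) , <ᵇ-sound (∧-right {cX =F cq} above) ,
  =F-sound (∧-left right) , <ᵇ-sound (∧-right {rY =F rq} right)
  where above = ∧-left e
        right = ∧-right {aboveSameCol (rX , cX) (rq , cq)} e

bCond-cells : ∀ {n} (x y z : Maybe (Cell n)) → bCond x y z ≡ true →
  Σ (Cell n) λ P → Σ (Cell n) λ Q → Σ (Cell n) λ S →
  x ≡ just P × y ≡ just Q × z ≡ just S × (Hook P Q S ⊎ Hook S Q P)
bCond-cells (just P) (just Q) (just S) e with ∨-cases {aboveSameCol P Q ∧ rightSameRow S Q} e
... | inj₁ e′ = P , Q , S , refl , refl , refl , inj₁ (hook P Q S e′)
... | inj₂ e′ = P , Q , S , refl , refl , refl , inj₂ (hook S Q P e′)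

bCond-sym : ∀ {n} (x y z : Maybe (Cell n)) → bCond x y z ≡ bCond z y x
bCond-sym (just p) (just q) (just s) = ∨-comm (aboveSameCol p q ∧ rightSameRow s q) _
bCond-sym (just _) (just _) nothing = refl
bCond-sym (just _) nothing (just _) = refl
bCond-sym (just _) nothing nothing = refl
bCond-sym nothing (just _) (just _) = refl
bCond-sym nothing (just _) nothing = refl
bCond-sym nothing nothing (just _) = refl
bCond-sym nothing nothing nothing = refl

HookEnds : ∀ {n} → Filling n → Cell n → Cell n → ℕ → Set
HookEnds T (rX , cX) (rY , cY) j = (T rX cX ≡ j × T rY cY ≡ suc (suc j)) ⊎ (T rX cX ≡ suc (suc j) × T rY cY ≡ j)

j<j+2 : ∀ j → j < suc (suc j)
j<j+2 j = <-trans (n<1+n j) (n<1+n (suc j))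

module Move𝔟 {n} (w : Permutation′ n) (j : ℕ) (T : Filling n) (sbt : IsSBT w T)
  (rX rq cq cY : Fin n) (dX : InD w rX cq) (dq : InD w rq cq) (dY : InD w rq cY)
  (rq<rX : toℕ rq < toℕ rX) (cq<cY : toℕ cq < toℕ cY) (tq : T rq cq ≡ suc j)
  (ends : HookEnds T (rX , cq) (rq , cY) j) where

  open Transposition j (suc (suc j)) (j<j+2 j)
  open Exchange w T

  window-values : ∀ {y} → Window y → y ≡ j ⊎ y ≡ suc j ⊎ y ≡ suc (suc j)
  window-values {y} (j≤y , y≤j+2) with y ≟ j | y ≟ suc j
  ... | yes y≡j | _ = inj₁ y≡j
  ... | no _ | yes y≡j+1 = inj₂ (inj₁ y≡j+1)
  ... | no y≢j | no y≢j+1 =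
    inj₂ (inj₂ (≤-antisym y≤j+2 (≤∧≢⇒< (≤∧≢⇒< j≤y (λ e → y≢j (sym e))) (λ e → y≢j+1 (sym e)))))

  data WindowCell (r c : Fin n) : Set where
    at-X : r ≡ rX × c ≡ cq → WindowCell r c
    at-q : r ≡ rq × c ≡ cq → WindowCell r c
    at-Y : r ≡ rq × c ≡ cY → WindowCell r c

  window-cell : ∀ r c → InD w r c → Window (T r c) → WindowCell r c
  window-cell r c d y-in = locate (window-values y-in) ends
    where
    locate : T r c ≡ j ⊎ T r c ≡ suc j ⊎ T r c ≡ suc (suc j) → HookEnds T (rX , cq) (rq , cY) j → WindowCell r c
    locate (inj₁ y≡j) (inj₁ (tX , _)) = at-X (same-cell w T (proj₁ sbt) d dX (trans y≡j (sym tX)))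
    locate (inj₁ y≡j) (inj₂ (_ , tY)) = at-Y (same-cell w T (proj₁ sbt) d dY (trans y≡j (sym tY)))
    locate (inj₂ (inj₁ y≡j+1)) _ = at-q (same-cell w T (proj₁ sbt) d dq (trans y≡j+1 (sym tq)))
    locate (inj₂ (inj₂ y≡j+2)) (inj₁ (_ , tY)) = at-Y (same-cell w T (proj₁ sbt) d dY (trans y≡j+2 (sym tY)))
    locate (inj₂ (inj₂ y≡j+2)) (inj₂ (tX , _)) = at-X (same-cell w T (proj₁ sbt) d dX (trans y≡j+2 (sym tX)))

  rows-differ : ∀ {r} → r ≡ rX → r ≡ rq → ⊥
  rows-differ r≡rX r≡rq = ≡⇒≮ (trans (sym r≡rq) r≡rX) rq<rX

  columns-differ : ∀ {c} → c ≡ cq → c ≡ cY → ⊥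
  columns-differ c≡cq c≡cY = ≡⇒≮ (trans (sym c≡cq) c≡cY) cq<cY

  row-pair : ∀ r c c′ → InD w r c → InD w r c′ → toℕ c < toℕ c′ → Window (T r c) → Window (T r c′) →
             r ≡ rq × c ≡ cq × c′ ≡ cY
  row-pair r c c′ d d′ c<c′ x-in y-in with window-cell r c d x-in | window-cell r c′ d′ y-in
  ... | at-q (r≡rq , c≡cq) | at-Y (_ , c′≡cY) = r≡rq , c≡cq , c′≡cY
  ... | at-X (_ , c≡cq) | at-X (_ , c′≡cq) = ⊥-elim (≡⇒≮ (trans c≡cq (sym c′≡cq)) c<c′)
  ... | at-q (_ , c≡cq) | at-q (_ , c′≡cq) = ⊥-elim (≡⇒≮ (trans c≡cq (sym c′≡cq)) c<c′)
  ... | at-Y (_ , c≡cY) | at-Y (_ , c′≡cY) = ⊥-elim (≡⇒≮ (trans c≡cY (sym c′≡cY)) c<c′)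
  ... | at-Y (_ , c≡cY) | at-q (_ , c′≡cq) = ⊥-elim (<-asym cq<cY (subst₂ (λ u v → toℕ u < toℕ v) c≡cY c′≡cq c<c′))
  ... | at-X (r≡rX , _) | at-q (r≡rq , _) = ⊥-elim (rows-differ r≡rX r≡rq)
  ... | at-X (r≡rX , _) | at-Y (r≡rq , _) = ⊥-elim (rows-differ r≡rX r≡rq)
  ... | at-q (r≡rq , _) | at-X (r≡rX , _) = ⊥-elim (rows-differ r≡rX r≡rq)
  ... | at-Y (r≡rq , _) | at-X (r≡rX , _) = ⊥-elim (rows-differ r≡rX r≡rq)

  column-pair : ∀ r r′ c → InD w r c → InD w r′ c → toℕ r < toℕ r′ → Window (T r c) → Window (T r′ c) →
                r ≡ rq × c ≡ cq × r′ ≡ rX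
  column-pair r r′ c d d′ r<r′ x-in y-in with window-cell r c d x-in | window-cell r′ c d′ y-in
  ... | at-q (r≡rq , c≡cq) | at-X (r′≡rX , _) = r≡rq , c≡cq , r′≡rX
  ... | at-X (r≡rX , _) | at-X (r′≡rX , _) = ⊥-elim (≡⇒≮ (trans r≡rX (sym r′≡rX)) r<r′)
  ... | at-q (r≡rq , _) | at-q (r′≡rq , _) = ⊥-elim (≡⇒≮ (trans r≡rq (sym r′≡rq)) r<r′)
  ... | at-Y (r≡rq , _) | at-Y (r′≡rq , _) = ⊥-elim (≡⇒≮ (trans r≡rq (sym r′≡rq)) r<r′)
  ... | at-X (r≡rX , _) | at-q (r′≡rq , _) = ⊥-elim (<-asym rq<rX (subst₂ (λ u v → toℕ u < toℕ v) r≡rX r′≡rq r<r′))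
  ... | at-X (_ , c≡cq) | at-Y (_ , c≡cY) = ⊥-elim (columns-differ c≡cq c≡cY)
  ... | at-q (_ , c≡cq) | at-Y (_ , c≡cY) = ⊥-elim (columns-differ c≡cq c≡cY)
  ... | at-Y (_ , c≡cY) | at-X (_ , c≡cq) = ⊥-elim (columns-differ c≡cq c≡cY)
  ... | at-Y (_ , c≡cY) | at-q (_ , c≡cq) = ⊥-elim (columns-differ c≡cq c≡cY)

  balanced-off-q : ∀ r c → InD w r c → ¬ (r ≡ rq × c ≡ cq) → rightLarger w T′ r c ≡ aboveSmaller w T′ r c
  balanced-off-q r c d not-q = balanced-away-from-window (proj₂ sbt) r c d
    (λ c′ d′ c<c′ x-in y-in → not-q (let (r≡ , c≡ , _) = row-pair r c c′ d d′ c<c′ x-in y-in in r≡ , c≡))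
    (λ r′ d′ r<r′ x-in y-in → not-q (let (r≡ , c≡ , _) = column-pair r r′ c d d′ r<r′ x-in y-in in r≡ , c≡))

  rightLarger-at-q : ∀ c′ → c′ ≢ cY → rightLargerTest w T′ rq cq c′ ≡ rightLargerTest w T rq cq c′
  rightLarger-at-q c′ c′≢cY = rightLargerTest-T′ rq cq c′ dq
    (λ d′ c<c′ x-in y-in → c′≢cY (proj₂ (proj₂ (row-pair rq cq c′ dq d′ c<c′ x-in y-in))))

  aboveSmaller-at-q : ∀ r′ → r′ ≢ rX → aboveSmallerTest w T′ rq cq r′ ≡ aboveSmallerTest w T rq cq r′
  aboveSmaller-at-q r′ r′≢rX = aboveSmallerTest-T′ rq cq r′ dq
    (λ d′ r<r′ x-in y-in → r′≢rX (proj₂ (proj₂ (column-pair rq r′ cq dq d′ r<r′ x-in y-in))))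

  rightLarger-at-Y : ∀ (U : Filling n) → rightLargerTest w U rq cq cY ≡ (U rq cq <ᵇ U rq cY)
  rightLarger-at-Y U = cong₂ _∧_ dY (cong (_∧ (U rq cq <ᵇ U rq cY)) (<ᵇ-complete cq<cY))

  aboveSmaller-at-X : ∀ (U : Filling n) → aboveSmallerTest w U rq cq rX ≡ (U rX cq <ᵇ U rq cq)
  aboveSmaller-at-X U = cong₂ _∧_ dX (cong (_∧ (U rX cq <ᵇ U rq cq)) (<ᵇ-complete rq<rX))

  T′-q : T′ rq cq ≡ suc j
  T′-q = trans (T′-on-D dq) (trans (cong σ tq) (σ-between (n<1+n j) (n<1+n (suc j))))

  j+1<j+2 : (suc j <ᵇ suc (suc j)) ≡ true
  j+1<j+2 = <ᵇ-complete (n<1+n (suc j))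

  j+1≮j : (suc j <ᵇ j) ≡ false
  j+1≮j = <ᵇ-false (λ p → <-asym p (n<1+n j))

  j<j+1 : (j <ᵇ suc j) ≡ true
  j<j+1 = <ᵇ-complete (n<1+n j)

  j+2≮j+1 : (suc (suc j) <ᵇ suc j) ≡ false
  j+2≮j+1 = <ᵇ-false (λ p → <-asym p (n<1+n (suc j)))

  -- At q both counts drop by one (when X holds j) or both grow by one (when X holds j+2).
  balanced-at-q : rightLarger w T′ rq cq ≡ aboveSmaller w T′ rq cq
  balanced-at-q = by-ends ends
    where
    by-ends : HookEnds T (rX , cq) (rq , cY) j → rightLarger w T′ rq cq ≡ aboveSmaller w T′ rq cq
    by-ends (inj₁ (tX , tY)) = ℕ-suc-injective (begin
      suc (rightLarger w T′ rq cq) ≡⟨ sym right-drops ⟩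
      rightLarger w T rq cq        ≡⟨ proj₂ sbt rq cq dq ⟩
      aboveSmaller w T rq cq       ≡⟨ above-drops ⟩
      suc (aboveSmaller w T′ rq cq) ∎)
      where
      open ≡-Reasoning
      right-drops : rightLarger w T rq cq ≡ suc (rightLarger w T′ rq cq)
      right-drops = count-extra _ _ cY (λ c′ ne → sym (rightLarger-at-q c′ ne))
        (trans (rightLarger-at-Y T) (trans (cong₂ _<ᵇ_ tq tY) j+1<j+2))
        (trans (rightLarger-at-Y T′) (trans (cong₂ _<ᵇ_ T′-q (trans (T′-on-D dY) (trans (cong σ tY) σ-b))) j+1≮j))
      above-drops : aboveSmaller w T rq cq ≡ suc (aboveSmaller w T′ rq cq)
      above-drops = count-extra _ _ rX (λ r′ ne → sym (aboveSmaller-at-q r′ ne))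
        (trans (aboveSmaller-at-X T) (trans (cong₂ _<ᵇ_ tX tq) j<j+1))
        (trans (aboveSmaller-at-X T′) (trans (cong₂ _<ᵇ_ (trans (T′-on-D dX) (trans (cong σ tX) σ-a)) T′-q) j+2≮j+1))
    by-ends (inj₂ (tX , tY)) = begin
      rightLarger w T′ rq cq        ≡⟨ right-grows ⟩
      suc (rightLarger w T rq cq)   ≡⟨ cong suc (proj₂ sbt rq cq dq) ⟩
      suc (aboveSmaller w T rq cq)  ≡⟨ sym above-grows ⟩
      aboveSmaller w T′ rq cq ∎
      where
      open ≡-Reasoning
      right-grows : rightLarger w T′ rq cq ≡ suc (rightLarger w T rq cq)
      right-grows = count-extra _ _ cY rightLarger-at-q
        (trans (rightLarger-at-Y T′) (trans (cong₂ _<ᵇ_ T′-q (trans (T′-on-D dY) (trans (cong σ tY) σ-a))) j+1<j+2))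
        (trans (rightLarger-at-Y T) (trans (cong₂ _<ᵇ_ tq tY) j+1≮j))
      above-grows : aboveSmaller w T′ rq cq ≡ suc (aboveSmaller w T rq cq)
      above-grows = count-extra _ _ rX aboveSmaller-at-q
        (trans (aboveSmaller-at-X T′) (trans (cong₂ _<ᵇ_ (trans (T′-on-D dX) (trans (cong σ tX) σ-b)) T′-q) j<j+1))
        (trans (aboveSmaller-at-X T) (trans (cong₂ _<ᵇ_ tX tq) j+2≮j+1))

  balanced : IsBalanced w T′
  balanced r c d with r ≟F rq | c ≟F cq
  ... | yes refl | yes refl = balanced-at-q
  ... | no r≢rq | _ = balanced-off-q r c d (λ (e , _) → r≢rq e)
  ... | yes _ | no c≢cq = balanced-off-q r c d (λ (_ , e) → c≢cq e)

𝔟-involution : ∀ {n} (w : Permutation′ n) (i : ℕ) → 1 < i → i < len w → ∀ (T : Filling n) → IsSBT w T →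
               IsSBT w (𝔟 w i T) × (𝔟 w i (𝔟 w i T) ≈[ w ] T)
𝔟-involution w (suc j) 1<i i<ℓ = conditional-swap-involution w cond (≤-pred 1<i) i<ℓ cond-stable balanced
  where
  open Transposition j (suc (suc j)) (j<j+2 j)

  cond : Filling _ → Bool
  cond T = bCond (posOf w T j) (posOf w T (suc j)) (posOf w T (suc (suc j)))

  -- After the exchange, j, j+1, j+2 sit where j+2, j+1, j sat.
  cond-stable : ∀ T → cond T ≡ true → cond (swapIf w true j (suc (suc j)) T) ≡ true
  cond-stable T e = begin
    bCond (posOf w T′ j) (posOf w T′ (suc j)) (posOf w T′ (suc (suc j)))
      ≡⟨ cong₂ (λ x yz → bCond x (proj₁ yz) (proj₂ yz)) (posOf-T′ j) (cong₂ _,_ (posOf-T′ (suc j)) (posOf-T′ (suc (suc j)))) ⟩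
    bCond (posOf w T (σ j)) (posOf w T (σ (suc j))) (posOf w T (σ (suc (suc j))))
      ≡⟨ cong₂ (λ k ml → bCond (posOf w T k) (posOf w T (proj₁ ml)) (posOf w T (proj₂ ml))) σ-a (cong₂ _,_ (σ-between (n<1+n j) (n<1+n (suc j))) σ-b) ⟩
    bCond (posOf w T (suc (suc j))) (posOf w T (suc j)) (posOf w T j)
      ≡⟨ bCond-sym (posOf w T (suc (suc j))) (posOf w T (suc j)) (posOf w T j) ⟩
    cond T
      ≡⟨ e ⟩
    true ∎
    where open ≡-Reasoning
          open Exchange w T

  balanced : ∀ T → IsSBT w T → cond T ≡ true → IsBalanced w (swapIf w true j (suc (suc j)) T)
  balanced T sbt e with bCond-cells _ _ _ e
  ... | (rP , cP) , (rQ , cQ) , (rS , cS) , eP , eQ , eS , inj₁ (refl , rQ<rP , refl , cQ<cS) =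
    let (dP , tP) = posOf-sound w T eP
        (dQ , tQ) = posOf-sound w T eQ
        (dS , tS) = posOf-sound w T eS
    in Move𝔟.balanced w j T sbt rP rQ cQ cS dP dQ dS rQ<rP cQ<cS tQ (inj₁ (tP , tS))
  ... | (rP , cP) , (rQ , cQ) , (rS , cS) , eP , eQ , eS , inj₂ (refl , rQ<rS , refl , cQ<cP) =
    let (dP , tP) = posOf-sound w T eP
        (dQ , tQ) = posOf-sound w T eQ
        (dS , tS) = posOf-sound w T eS
    in Move𝔟.balanced w j T sbt rS rQ cQ cP dS dQ dP rQ<rS cQ<cP tQ (inj₂ (tS , tP))

lemma3p11 : ∀ (n : ℕ) (w : Permutation′ n) →
    (∀ (i : ℕ) → 1 ≤ i → i < len w → ∀ (T : Filling n) → IsSBT w T →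
        IsSBT w (𝔠 w i T) × (𝔠 w i (𝔠 w i T) ≈[ w ] T))
    × (∀ (i : ℕ) → 1 < i → i < len w → ∀ (T : Filling n) → IsSBT w T →
        IsSBT w (𝔟 w i T) × (𝔟 w i (𝔟 w i T) ≈[ w ] T))
lemma3p11 n w = 𝔠-involution w , 𝔟-involution w
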